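{- For a positive integer $n$, let $f(n)$ denote the number of partitions $\lambda \vdash n$ having a fixed hook, i.e. partitions $\lambda=(\lambda_1,\dots,\lambda_t)$ for which there exists an index $i$ with $1\le i\le t$ and $h_{i,1}(\lambda)=i$. Then $$f(n)=\sum_{\lambda\vdash n}\#\{\, i\ge 1 : \text{the part } i \text{ appears in } \lambda \text{ with multiplicity exactly } i\,\}.$$
   Context: A partition $\lambda=(\lambda_1,\dots,\lambda_t)$ of $n$ is a nonincreasing sequence of positive integers with sum $n$; $t$ is its number of parts. The first-column hook lengths of $\lambda$ are $h_{i,1}(\lambda)=\lambda_i+t-i$ for $1\le i\le t$ (this is the hook length of the box $(i,1)$ of the Young diagram, $h_{i,j}(\lambda)=\lambda_i+\lambda'_j-i-j+1$ with $\lambda'$ the conjugate partition). A fixed hook of $\lambda$ is an index $i$ with $h_{i,1}(\lambda)=i$. -}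

module Defs where

open import Data.Nat using (ℕ; zero; suc; _+_; _∸_; _≟_; _≤?_)
open import Data.List using (List; []; _∷_; length; map; concatMap; upTo; filter; lookup)
open import Data.Fin using (Fin; toℕ)
open import Data.Product using (Σ; _×_)
open import Data.List.Relation.Unary.Any using (Any)
open import Relation.Binary.PropositionalEquality using (_≡_)
open import Relation.Nullary.Decidable using (Dec)
open import Data.Fin.Properties using (any?)
open import Data.Product using (∃)

-- A partition is represented as a list (λ₁, …, λ_t) of positive parts,
-- nonincreasing.  The number of parts is t = length λ.

-- partitionsBounded m n : all partitions of n (as nonincreasing lists of
-- positive integers) whose largest part is ≤ m.  Structural recursion on a
-- fuel argument k ≥ n.
partsB : ℕ → ℕ → ℕ → List (List ℕ)
partsB zero    m zero    = [] ∷ []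
partsB zero    m (suc n) = []
partsB (suc k) m zero    = [] ∷ []
partsB (suc k) m (suc n) =
  concatMap (λ j → map (λ μ → suc j ∷ μ) (partsB k (suc j) (suc n ∸ suc j)))
            (filter (λ j → suc j ≤? m) (upTo (suc n)))

partitions : ℕ → List (List ℕ)
partitions n = partsB n n n

-- First-column hook length h_{i,1}(λ) = λ_i + t - i, with i 1-based;
-- here i = suc (toℕ p) for the 0-based position p.
hook1 : (λs : List ℕ) → Fin (length λs) → ℕ
hook1 λs p = lookup λs p + length λs ∸ suc (toℕ p)

HasFixedHook : List ℕ → Set
HasFixedHook λs = Σ (Fin (length λs)) (λ p → hook1 λs p ≡ suc (toℕ p))

mult : ℕ → List ℕ → ℕ
mult i λs = length (filter (λ x → x ≟ i) λs)

-- #{ i ≥ 1 : part i occurs in λ with multiplicity exactly i }.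
-- Such i satisfy i ≤ |λ| ≤ ... ; i ≤ length λ, so we range over 1..length λ.
fixedMultCount : List ℕ → ℕ
fixedMultCount λs = length (filter (λ i → mult (suc i) λs ≟ suc i) (upTo (length λs)))

hasFixedHook? : (λs : List ℕ) → Dec (HasFixedHook λs)
hasFixedHook? λs = any? (λ p → hook1 λs p ≟ suc (toℕ p))

f : ℕ → ℕ
f n = length (filter hasFixedHook? (partitions n))

-- A partition has at most one fixed hook, because h_{i,1} − i = λ_i + t − 2i strictly decreases
-- in i.  So f(n) = Σ_k #{λ ⊢ n with a fixed hook in a part equal to k}, and by double counting
-- the right-hand side is Σ_k #{λ ⊢ n in which k occurs exactly k times}; for each k = c + 1 the
-- two sets are in bijection.
--
-- A fixed hook in a part k means λ = top ++ k ∷ bot with |top| = c + |bot|.  Subtracting k from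
-- top and 1 from bot leaves a nonincreasing list xs of length c + m and a nonincreasing list gs of
-- length m with entries ≤ c.  A part k of multiplicity k means λ = big ++ kᵏ ++ small; subtracting
-- k + 1 from big and conjugating small (whose parts are < k) leaves nonincreasing lists vs of
-- length m and as of length c.  In both encodings |λ| is the sum of the entries plus
-- m(c + 2) + (c + 1)², and merging as into vs is a bijection (as, vs) ↔ (xs, gs) preserving the sum
-- of the entries: a bijective proof of 1/((q)_c (q)_m) = [c+m choose m]_q / (q)_{c+m}.

module Submission where

open import Defs
open import Data.Nat using (ℕ; zero; suc; pred; _+_; _*_; _∸_; _≤_; _<_; _≟_; _≤?_; _<?_; z≤n; s≤s; z<s; ⌊_/2⌋)
open import Data.Nat.Properties
open import Data.Nat.ListAction using (sum)
open import Data.Nat.ListAction.Properties using (sum-++)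
open import Data.Fin using (Fin; toℕ)
open import Data.Fin.Properties using (any?; toℕ<n; toℕ-injective)
open import Data.List using (List; []; _∷_; _++_; [_]; length; map; filter; replicate; take; drop; lookup; upTo; removeAt)
open import Data.List.Properties hiding (sum-++)
open import Data.List.Relation.Unary.All as All using (All; []; _∷_)
open import Data.List.Relation.Unary.Any using (here; there; index)
open import Data.List.Relation.Unary.Unique.Propositional using (Unique; []; _∷_)
import Data.List.Relation.Unary.Unique.Propositional.Properties as Unique
import Data.List.Relation.Unary.All.Properties as All
import Data.List.Relation.Unary.AllPairs as AllPairs
import Data.List.Relation.Unary.AllPairs.Properties as AllPairs
open import Data.List.Membership.Propositional using (_∈_; find; lose)
open import Data.List.Membership.Propositional.Properties
open import Data.List.Relation.Binary.Subset.Propositional using (_⊆_)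
open import Data.Product using (Σ; ∃₂; _×_; _,_; proj₁; proj₂; uncurry; map₁; map₂)
open import Data.Empty using (⊥; ⊥-elim)
open import Data.Unit using (⊤; tt)
open import Function using (_∘_)
open import Relation.Nullary using (¬_; Dec; yes; no; does)
open import Data.Bool using (true; false)
open import Relation.Nullary.Decidable using (_×-dec_)
open import Level using (0ℓ)
open import Relation.Unary using (Pred; Decidable)
open import Relation.Binary using (tri<; tri≈; tri>)
open import Relation.Binary.PropositionalEquality hiding ([_])
open import Data.Nat.Tactic.RingSolver using (solve-∀)
open import Algebra.Properties.CommutativeSemigroup +-commutativeSemigroup using (interchange; x∙yz≈y∙xz)

-- Counting

count : ∀ {A : Set} {P : Pred A 0ℓ} → Decidable P → List A → ℕ
count P? xs = length (filter P? xs)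

module _ {A : Set} where

  ∈-removeAt : ∀ {x y : A} {ys} (x∈ys : x ∈ ys) → y ∈ ys → y ≢ x → y ∈ removeAt ys (index x∈ys)
  ∈-removeAt (here refl) (here refl)  y≢x = ⊥-elim (y≢x refl)
  ∈-removeAt (here refl) (there y∈ys) _   = y∈ys
  ∈-removeAt (there _)   (here refl)  _   = here refl
  ∈-removeAt (there x∈ys) (there y∈ys) y≢x = there (∈-removeAt x∈ys y∈ys y≢x)

  unique⊆⇒length≤ : ∀ {xs ys : List A} → Unique xs → xs ⊆ ys → length xs ≤ length ys
  unique⊆⇒length≤ {[]}     _            _     = z≤n
  unique⊆⇒length≤ {x ∷ xs} {ys} (x∉xs ∷ xs!) xs⊆ys = begin
    suc (length xs)                         ≤⟨ s≤s (unique⊆⇒length≤ xs! xs⊆ys-x) ⟩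
    suc (length (removeAt ys (index x∈ys))) ≡⟨ length-removeAt′ ys (index x∈ys) ⟨
    length ys                               ∎
    where
    open ≤-Reasoning
    x∈ys = xs⊆ys (here refl)
    xs⊆ys-x : xs ⊆ removeAt ys (index x∈ys)
    xs⊆ys-x y∈xs = ∈-removeAt x∈ys (xs⊆ys (there y∈xs)) (λ y≡x → All.lookup x∉xs y∈xs (sym y≡x))

  unique-⊆⊇⇒length≡ : ∀ {xs ys : List A} → Unique xs → Unique ys → xs ⊆ ys → ys ⊆ xs → length xs ≡ length ys
  unique-⊆⊇⇒length≡ xs! ys! xs⊆ys ys⊆xs = ≤-antisym (unique⊆⇒length≤ xs! xs⊆ys) (unique⊆⇒length≤ ys! ys⊆xs)

  sum-map-+ : (f g : A → ℕ) (xs : List A) → sum (map (λ x → f x + g x) xs) ≡ sum (map f xs) + sum (map g xs)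
  sum-map-+ f g []       = refl
  sum-map-+ f g (x ∷ xs) = trans (cong (f x + g x +_) (sum-map-+ f g xs)) (interchange (f x) (g x) _ _)

  sum-map-zero : (xs : List A) → sum (map (λ _ → 0) xs) ≡ 0
  sum-map-zero []       = refl
  sum-map-zero (_ ∷ xs) = sum-map-zero xs

  count≡sum : ∀ {P : Pred A 0ℓ} (P? : Decidable P) (g : A → ℕ) xs →
              (∀ {x} → x ∈ xs → P x → g x ≡ 1) → (∀ {x} → x ∈ xs → ¬ P x → g x ≡ 0) →
              count P? xs ≡ sum (map g xs)
  count≡sum P? g []       _   _    = refl
  count≡sum P? g (x ∷ xs) yes⇒1 no⇒0 with P? x
  ... | yes px = cong₂ _+_ (sym (yes⇒1 (here refl) px)) (count≡sum P? g xs (yes⇒1 ∘ there) (no⇒0 ∘ there))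
  ... | no ¬px = cong₂ _+_ (sym (no⇒0 (here refl) ¬px)) (count≡sum P? g xs (yes⇒1 ∘ there) (no⇒0 ∘ there))

module _ {A B : Set} {R : A → B → Set} (R? : ∀ x y → Dec (R x y)) where

  double-counting : ∀ xs ys →
    sum (map (λ x → count (R? x) ys) xs) ≡ sum (map (λ y → count (λ x → R? x y) xs) ys)
  double-counting []       ys = sym (sum-map-zero ys)
  double-counting (x ∷ xs) ys = begin
    count (R? x) ys + sum (map (λ x → count (R? x) ys) xs)
      ≡⟨ cong₂ _+_ (count≡sum (R? x) _ ys (λ _ → count-singleton-yes) (λ _ → count-singleton-no))
                   (double-counting xs ys) ⟩
    sum (map (λ y → count (λ x → R? x y) [ x ]) ys) + sum (map (λ y → count (λ x → R? x y) xs) ys)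
      ≡⟨ sum-map-+ _ _ ys ⟨
    sum (map (λ y → count (λ x → R? x y) [ x ] + count (λ x → R? x y) xs) ys)
      ≡⟨ cong sum (map-cong (λ y → sym (length-++ (filter (λ x → R? x y) [ x ])) ) ys) ⟩
    sum (map (λ y → length (filter (λ x → R? x y) [ x ] ++ filter (λ x → R? x y) xs)) ys)
      ≡⟨ cong sum (map-cong (λ y → cong length (filter-++ (λ x → R? x y) [ x ] xs)) ys) ⟨
    sum (map (λ y → count (λ x → R? x y) (x ∷ xs)) ys) ∎
    where
    open ≡-Reasoning
    count-singleton-yes : ∀ {y} → R x y → count (λ x → R? x y) [ x ] ≡ 1
    count-singleton-yes r = cong length (filter-accept (λ x → R? x _) r)
    count-singleton-no : ∀ {y} → ¬ R x y → count (λ x → R? x y) [ x ] ≡ 0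
    count-singleton-no ¬r = cong length (filter-reject (λ x → R? x _) ¬r)

module _ {A : Set} {S : Pred A 0ℓ} {xs : List A} (xs! : Unique xs)
         (sound : ∀ {x} → x ∈ xs → S x) (complete : ∀ {x} → S x → x ∈ xs) where

  count-≤-by-retraction : ∀ {P Q : Pred A 0ℓ} (P? : Decidable P) (Q? : Decidable Q) (F G : A → A) →
    (∀ {x} → S x → P x → S (F x) × Q (F x) × G (F x) ≡ x) → count P? xs ≤ count Q? xs
  count-≤-by-retraction P? Q? F G forth = begin
    length (filter P? xs)         ≡⟨ length-map F (filter P? xs) ⟨
    length (map F (filter P? xs)) ≤⟨ unique⊆⇒length≤ image! image⊆ ⟩
    length (filter Q? xs)         ∎
    where
    open ≤-Reasoning
    image⊆ : map F (filter P? xs) ⊆ filter Q? xs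
    image⊆ y∈ with x , x∈ , refl ← ∈-map⁻ F y∈ with x∈xs , px ← ∈-filter⁻ P? x∈ =
      let sFx , qFx , _ = forth (sound x∈xs) px in ∈-filter⁺ Q? (complete sFx) qFx
    G∘F≗id : All (λ x → G (F x) ≡ x) (filter P? xs)
    G∘F≗id = All.tabulate λ x∈ → let x∈xs , px = ∈-filter⁻ P? x∈ in proj₂ (proj₂ (forth (sound x∈xs) px))
    image! : Unique (map F (filter P? xs))
    image! = Unique.map⁻ {f = G} (subst Unique (sym (trans (sym (map-∘ (filter P? xs))) (map-id-local G∘F≗id)))
                                        (Unique.filter⁺ P? xs!))

  count-≡-by-bijection : ∀ {P Q : Pred A 0ℓ} (P? : Decidable P) (Q? : Decidable Q) (F G : A → A) →
    (∀ {x} → S x → P x → S (F x) × Q (F x) × G (F x) ≡ x) →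
    (∀ {y} → S y → Q y → S (G y) × P (G y) × F (G y) ≡ y) →
    count P? xs ≡ count Q? xs
  count-≡-by-bijection P? Q? F G forth back =
    ≤-antisym (count-≤-by-retraction P? Q? F G forth) (count-≤-by-retraction Q? P? G F back)

count-upTo-unique : ∀ {P : Pred ℕ 0ℓ} (P? : Decidable P) {n k} → 0 < k → k ≤ n → P k → (∀ {j} → P j → j ≡ k) →
                    count (λ i → P? (suc i)) (upTo n) ≡ 1
count-upTo-unique P? {n} {suc i} _ i<n pk unique =
  unique-⊆⊇⇒length≡ {ys = [ i ]} (Unique.filter⁺ (P? ∘ suc) (Unique.upTo⁺ n)) ([] ∷ []) ⊆[i] [i]⊆
  where
  ⊆[i] : filter (P? ∘ suc) (upTo n) ⊆ [ i ]
  ⊆[i] j∈ = here (suc-injective (unique (proj₂ (∈-filter⁻ (P? ∘ suc) {xs = upTo n} j∈))))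
  [i]⊆ : [ i ] ⊆ filter (P? ∘ suc) (upTo n)
  [i]⊆ (here refl) = ∈-filter⁺ (P? ∘ suc) (∈-upTo⁺ i<n) pk

module _ {A : Set} where

  length-++-∷ : ∀ (ys : List A) {x zs} → length (ys ++ x ∷ zs) ≡ suc (length ys) + length zs
  length-++-∷ ys {x} {zs} = trans (length-++ ys) (+-suc (length ys) (length zs))

  split-at : (xs : List A) (p : Fin (length xs)) →
             ∃₂ λ ys zs → xs ≡ ys ++ lookup xs p ∷ zs × length ys ≡ toℕ p
  split-at (x ∷ xs) Fin.zero    = [] , xs , refl , refl
  split-at (x ∷ xs) (Fin.suc p) with ys , zs , xs≡ , len ← split-at xs p =
    x ∷ ys , zs , cong (x ∷_) xs≡ , cong suc len

  position-of : (ys : List A) (x : A) (zs : List A) →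
                Σ (Fin (length (ys ++ x ∷ zs))) λ p → toℕ p ≡ length ys × lookup (ys ++ x ∷ zs) p ≡ x
  position-of []       x zs = Fin.zero , refl , refl
  position-of (y ∷ ys) x zs with p , p≡ , lookup≡ ← position-of ys x zs = Fin.suc p , cong suc p≡ , lookup≡

  take-length-++ : ∀ (xs : List A) {ys} → take (length xs) (xs ++ ys) ≡ xs
  take-length-++ []       = refl
  take-length-++ (x ∷ xs) = cong (x ∷_) (take-length-++ xs)

  drop-length-++-∷ : ∀ (xs : List A) {y ys} → drop (suc (length xs)) (xs ++ y ∷ ys) ≡ ys
  drop-length-++-∷ []       = refl
  drop-length-++-∷ (x ∷ xs) = drop-length-++-∷ xs

length≤sum : ∀ {xs} → All (0 <_) xs → length xs ≤ sum xs
length≤sum []           = z≤n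
length≤sum (0<x ∷ 0<xs) = +-mono-≤ 0<x (length≤sum 0<xs)

sum-map-shift : ∀ {d} (f : ℕ → ℕ) → (∀ x → f x ≡ x + d) → ∀ xs → sum (map f xs) ≡ sum xs + length xs * d
sum-map-shift     f f≡ []       = refl
sum-map-shift {d} f f≡ (x ∷ xs) = begin
  f x + sum (map f xs)             ≡⟨ cong₂ _+_ (f≡ x) (sum-map-shift f f≡ xs) ⟩
  x + d + (sum xs + length xs * d) ≡⟨ interchange x d (sum xs) _ ⟩
  x + sum xs + (d + length xs * d) ∎
  where open ≡-Reasoning

sum-replicate : ∀ n x → sum (replicate n x) ≡ n * x
sum-replicate zero    x = refl
sum-replicate (suc n) x = cong (x +_) (sum-replicate n x)

map-pred-suc : ∀ xs → map pred (map suc xs) ≡ xs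
map-pred-suc xs = trans (sym (map-∘ xs)) (map-id xs)

map-suc-pred : ∀ {xs} → All (0 <_) xs → map suc (map pred xs) ≡ xs
map-suc-pred {xs} pos = trans (sym (map-∘ xs)) (map-id-local (All.map (λ { {suc _} _ → refl }) pos))

map-∸-+ : ∀ d xs → map (_∸ d) (map (_+ d) xs) ≡ xs
map-∸-+ d xs = trans (sym (map-∘ xs)) (map-id-local (All.universal (λ x → m+n∸n≡m x d) xs))

map-+-∸ : ∀ d {xs} → All (d ≤_) xs → map (_+ d) (map (_∸ d) xs) ≡ xs
map-+-∸ d {xs} d≤ = trans (sym (map-∘ xs)) (map-id-local (All.map m∸n+n≡m d≤))

all-map-suc-positive : ∀ xs → All (0 <_) (map suc xs)
all-map-suc-positive xs = All.map⁺ (All.universal (λ _ → z<s) xs)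

⌊1+n+n/2⌋≡n : ∀ n → ⌊ suc (n + n) /2⌋ ≡ n
⌊1+n+n/2⌋≡n zero    = refl
⌊1+n+n/2⌋≡n (suc n) = cong suc (trans (cong ⌊_/2⌋ (+-suc n n)) (⌊1+n+n/2⌋≡n n))

-- Nonincreasing lists

Desc≤ : ℕ → List ℕ → Set
Desc≤ m []       = ⊤
Desc≤ m (x ∷ xs) = x ≤ m × Desc≤ x xs

hd : List ℕ → ℕ
hd []      = 0
hd (x ∷ _) = x

hd≤ : ∀ {m} xs → Desc≤ m xs → hd xs ≤ m
hd≤ []       _         = z≤n
hd≤ (x ∷ xs) (x≤m , _) = x≤m

Desc≤-weaken : ∀ {m m′} xs → m ≤ m′ → Desc≤ m xs → Desc≤ m′ xs
Desc≤-weaken []       _    _         = tt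
Desc≤-weaken (x ∷ xs) m≤m′ (x≤m , d) = ≤-trans x≤m m≤m′ , d

Desc≤⇒All≤ : ∀ {m} xs → Desc≤ m xs → All (_≤ m) xs
Desc≤⇒All≤ []       _         = []
Desc≤⇒All≤ (x ∷ xs) (x≤m , d) = x≤m ∷ All.map (λ y≤x → ≤-trans y≤x x≤m) (Desc≤⇒All≤ xs d)

Desc≤-map : ∀ {f : ℕ → ℕ} → (∀ {x y} → x ≤ y → f x ≤ f y) → ∀ {m} xs → Desc≤ m xs → Desc≤ (f m) (map f xs)
Desc≤-map mono []       _         = tt
Desc≤-map mono (x ∷ xs) (x≤m , d) = mono x≤m , Desc≤-map mono xs d

Desc≤-++ : ∀ {m y} xs ys → y ≤ m → Desc≤ m xs → All (y ≤_) xs → Desc≤ y ys → Desc≤ m (xs ++ ys)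
Desc≤-++ []       ys y≤m _         _           d = Desc≤-weaken ys y≤m d
Desc≤-++ (x ∷ xs) ys _   (x≤m , d) (y≤x ∷ y≤xs) e = x≤m , Desc≤-++ xs ys y≤x d y≤xs e

Desc≤-++⁻ : ∀ {m y} xs ys → Desc≤ m (xs ++ y ∷ ys) → Desc≤ m xs × All (y ≤_) xs × Desc≤ y ys
Desc≤-++⁻ []       ys (_ , d)   = tt , [] , d
Desc≤-++⁻ (x ∷ xs) ys (x≤m , d) with dxs , y≤xs , dys ← Desc≤-++⁻ xs ys d =
  (x≤m , dxs) , All.lookup (Desc≤⇒All≤ (xs ++ _ ∷ ys) d) (∈-++⁺ʳ xs (here refl)) ∷ y≤xs , dys

Desc≤-rebound : ∀ {m c} xs → Desc≤ m xs → All (_≤ c) xs → Desc≤ c xs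
Desc≤-rebound []       _       _         = tt
Desc≤-rebound (x ∷ xs) (_ , d) (x≤c ∷ _) = x≤c , d

Desc≤-replicate : ∀ n m → Desc≤ m (replicate n m)
Desc≤-replicate zero    m = tt
Desc≤-replicate (suc n) m = ≤-refl , Desc≤-replicate n m

Desc≤-filter : ∀ {P : Pred ℕ 0ℓ} (P? : Decidable P) {m} xs → Desc≤ m xs → Desc≤ m (filter P? xs)
Desc≤-filter P? []       _         = tt
Desc≤-filter P? (x ∷ xs) (x≤m , d) with does (P? x)
... | true  = x≤m , Desc≤-filter P? xs d
... | false = Desc≤-weaken (filter P? xs) x≤m (Desc≤-filter P? xs d)

Desc≤-sum : ∀ {m} xs → Desc≤ m xs → Desc≤ (sum xs) xs
Desc≤-sum []       _       = tt
Desc≤-sum (x ∷ xs) (_ , d) = m≤m+n x (sum xs) , d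

lookup-antitone : ∀ {m} xs → Desc≤ m xs → (p q : Fin (length xs)) → toℕ p ≤ toℕ q → lookup xs q ≤ lookup xs p
lookup-antitone (x ∷ xs) _       Fin.zero    Fin.zero    _       = ≤-refl
lookup-antitone (x ∷ xs) (_ , d) Fin.zero    (Fin.suc q) _       = All.lookup (Desc≤⇒All≤ xs d) (∈-lookup q)
lookup-antitone (x ∷ xs) (_ , d) (Fin.suc p) (Fin.suc q) (s≤s p≤q) = lookup-antitone xs d p q p≤q

-- Partitions

record IsPartition (n : ℕ) (λs : List ℕ) : Set where
  field
    desc     : Desc≤ n λs
    positive : All (0 <_) λs
    sum≡     : sum λs ≡ n

desc⇒isPartition : ∀ {m n} λs → Desc≤ m λs → All (0 <_) λs → sum λs ≡ n → IsPartition n λs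
desc⇒isPartition λs d pos sum≡ = record
  { desc = subst (λ s → Desc≤ s λs) sum≡ (Desc≤-sum λs d) ; positive = pos ; sum≡ = sum≡ }

-- partsB (suc k) m (suc n) unfolds to concatMap (branch k n) (firstParts m n).
branch : ℕ → ℕ → ℕ → List (List ℕ)
branch k n j = map (λ μ → suc j ∷ μ) (partsB k (suc j) (suc n ∸ suc j))

firstParts : ℕ → ℕ → List ℕ
firstParts m n = filter (λ j → suc j ≤? m) (upTo (suc n))

∈-partsB⁻ : ∀ k m n {λs} → λs ∈ partsB k m n → Desc≤ m λs × All (0 <_) λs × sum λs ≡ n
∈-partsB⁻ zero    m zero    (here refl) = tt , [] , refl
∈-partsB⁻ (suc k) m zero    (here refl) = tt , [] , refl
∈-partsB⁻ (suc k) m (suc n) λs∈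
  with j , j∈ , λs∈branch ← find (∈-concatMap⁻ (branch k n) {xs = firstParts m n} λs∈)
  with j<1+n , 1+j≤m ← ∈-filter⁻ (λ j → suc j ≤? m) {xs = upTo (suc n)} j∈
  with μ , μ∈ , refl ← ∈-map⁻ (λ μ → suc j ∷ μ) λs∈branch
  with desc , pos , sum≡ ← ∈-partsB⁻ k (suc j) (n ∸ j) μ∈
  = (1+j≤m , desc) , s≤s z≤n ∷ pos , cong suc (trans (cong (j +_) sum≡) (m+[n∸m]≡n (≤-pred (∈-upTo⁻ j<1+n))))

∈-partsB⁺ : ∀ k m n {λs} → n ≤ k → Desc≤ m λs → All (0 <_) λs → sum λs ≡ n → λs ∈ partsB k m n
∈-partsB⁺ zero    m zero    {[]}         _         _          _       _    = here refl
∈-partsB⁺ (suc k) m zero    {[]}         _         _          _       _    = here refl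
∈-partsB⁺ k       m (suc n) {[]}         _         _          _       ()
∈-partsB⁺ zero    m zero    {suc j ∷ μ}  _         _          _       ()
∈-partsB⁺ (suc k) m zero    {suc j ∷ μ}  _         _          _       ()
∈-partsB⁺ (suc k) m (suc n) {suc j ∷ μ}  (s≤s n≤k) (1+j≤m , d) (_ ∷ p) sum≡ =
  ∈-concatMap⁺ (branch k n) {xs = firstParts m n} (lose j∈ (∈-map⁺ (λ μ → suc j ∷ μ) μ∈))
  where
  j+sumμ≡n : j + sum μ ≡ n
  j+sumμ≡n = suc-injective sum≡
  j∈ : j ∈ firstParts m n
  j∈ = ∈-filter⁺ (λ j → suc j ≤? m) (∈-upTo⁺ (s≤s (subst (j ≤_) j+sumμ≡n (m≤m+n j (sum μ))))) 1+j≤m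
  μ∈ : μ ∈ partsB k (suc j) (n ∸ j)
  μ∈ = ∈-partsB⁺ k (suc j) (n ∸ j) (≤-trans (m∸n≤m n j) n≤k) d p
         (sym (trans (cong (_∸ j) (sym j+sumμ≡n)) (m+n∸m≡n j (sum μ))))
∈-partsB⁺ k m n {zero ∷ μ} _ _ (() ∷ _) _

partsB-unique : ∀ k m n → Unique (partsB k m n)
partsB-unique zero    m zero    = [] ∷ []
partsB-unique zero    m (suc n) = []
partsB-unique (suc k) m zero    = [] ∷ []
partsB-unique (suc k) m (suc n) =
  Unique.concat⁺ (All.map⁺ (All.universal branch! (firstParts m n)))
                 (AllPairs.map⁺ (AllPairs.map disjoint (Unique.filter⁺ (λ j → suc j ≤? m) (Unique.upTo⁺ (suc n)))))
  where
  branch! : ∀ j → Unique (branch k n j)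
  branch! j = Unique.map⁺ (λ eq → proj₂ (∷-injective eq)) (partsB-unique k (suc j) (suc n ∸ suc j))
  disjoint : ∀ {i j} → i ≢ j → ∀ {λs} → ¬ (λs ∈ branch k n i × λs ∈ branch k n j)
  disjoint i≢j (λs∈i , λs∈j) with _ , _ , refl ← ∈-map⁻ _ λs∈i with _ , _ , eq ← ∈-map⁻ _ λs∈j =
    i≢j (suc-injective (proj₁ (∷-injective eq)))

∈-partitions⁻ : ∀ {n λs} → λs ∈ partitions n → IsPartition n λs
∈-partitions⁻ {n} λs∈ with desc , positive , sum≡ ← ∈-partsB⁻ n n n λs∈ =
  record { desc = desc ; positive = positive ; sum≡ = sum≡ }

∈-partitions⁺ : ∀ {n λs} → IsPartition n λs → λs ∈ partitions n
∈-partitions⁺ {n} p = ∈-partsB⁺ n n n ≤-refl desc positive sum≡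
  where open IsPartition p

partitions-unique : ∀ n → Unique (partitions n)
partitions-unique n = partsB-unique n n n

-- Fixed hooks

IsFixedHook : (λs : List ℕ) → Fin (length λs) → Set
IsFixedHook λs p = hook1 λs p ≡ suc (toℕ p)

HasFixedHookOfPart : ℕ → List ℕ → Set
HasFixedHookOfPart k λs = Σ (Fin (length λs)) λ p → IsFixedHook λs p × lookup λs p ≡ k

hasFixedHookOfPart? : ∀ k λs → Dec (HasFixedHookOfPart k λs)
hasFixedHookOfPart? k λs = any? λ p → (hook1 λs p ≟ suc (toℕ p)) ×-dec (lookup λs p ≟ k)

hook1≡ : ∀ λs (p : Fin (length λs)) {b} → length λs ≡ suc (toℕ p) + b → hook1 λs p ≡ lookup λs p + b
hook1≡ λs p {b} len = begin
  lookup λs p + length λs ∸ suc (toℕ p)         ≡⟨ cong (λ t → lookup λs p + t ∸ suc (toℕ p)) len ⟩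
  lookup λs p + (suc (toℕ p) + b) ∸ suc (toℕ p) ≡⟨ cong (_∸ suc (toℕ p)) (x∙yz≈y∙xz (lookup λs p) _ b) ⟩
  suc (toℕ p) + (lookup λs p + b) ∸ suc (toℕ p) ≡⟨ m+n∸m≡n (suc (toℕ p)) _ ⟩
  lookup λs p + b                               ∎
  where open ≡-Reasoning

fixedHook⇒lookup+length : ∀ λs (p : Fin (length λs)) → IsFixedHook λs p →
                          lookup λs p + length λs ≡ suc (toℕ p) + suc (toℕ p)
fixedHook⇒lookup+length λs p fixed = begin
  lookup λs p + length λs                         ≡⟨ m∸n+n≡m (≤-trans (toℕ<n p) (m≤n+m (length λs) (lookup λs p))) ⟨
  lookup λs p + length λs ∸ suc (toℕ p) + suc (toℕ p) ≡⟨ cong (_+ suc (toℕ p)) fixed ⟩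
  suc (toℕ p) + suc (toℕ p)                       ∎
  where open ≡-Reasoning

no-two-fixedHooks : ∀ {m} λs → Desc≤ m λs → (p q : Fin (length λs)) → toℕ p < toℕ q →
                    IsFixedHook λs p → IsFixedHook λs q → ⊥
no-two-fixedHooks λs d p q p<q fp fq = <-irrefl refl (begin-strict
  lookup λs q + length λs   ≤⟨ +-monoˡ-≤ (length λs) (lookup-antitone λs d p q (<⇒≤ p<q)) ⟩
  lookup λs p + length λs   ≡⟨ fixedHook⇒lookup+length λs p fp ⟩
  suc (toℕ p) + suc (toℕ p) <⟨ +-mono-< (s≤s p<q) (s≤s p<q) ⟩
  suc (toℕ q) + suc (toℕ q) ≡⟨ fixedHook⇒lookup+length λs q fq ⟨
  lookup λs q + length λs   ∎)
  where open ≤-Reasoning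

fixedHook-unique : ∀ {m} λs → Desc≤ m λs → (p q : Fin (length λs)) → IsFixedHook λs p → IsFixedHook λs q → p ≡ q
fixedHook-unique λs d p q fp fq with <-cmp (toℕ p) (toℕ q)
... | tri< p<q _ _ = ⊥-elim (no-two-fixedHooks λs d p q p<q fp fq)
... | tri≈ _ p≡q _ = toℕ-injective p≡q
... | tri> _ _ q<p = ⊥-elim (no-two-fixedHooks λs d q p q<p fq fp)

fixedHookOfPart-unique : ∀ {m k k′} λs → Desc≤ m λs → HasFixedHookOfPart k λs → HasFixedHookOfPart k′ λs → k ≡ k′
fixedHookOfPart-unique λs d (p , fp , refl) (q , fq , refl) = cong (lookup λs) (fixedHook-unique λs d p q fp fq)

FixedHookSplit : ℕ → List ℕ → Set
FixedHookSplit k λs = ∃₂ λ top bot → λs ≡ top ++ k ∷ bot × suc (length top) ≡ k + length bot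

fixedHook⇒split : ∀ {k} λs → HasFixedHookOfPart k λs → FixedHookSplit k λs
fixedHook⇒split λs (p , fixed , refl) with top , bot , λs≡ , top≡p ← split-at λs p =
  top , bot , λs≡ , (begin
    suc (length top)         ≡⟨ cong suc top≡p ⟩
    suc (toℕ p)              ≡⟨ fixed ⟨
    hook1 λs p               ≡⟨ hook1≡ λs p (trans (cong length λs≡)
                                    (trans (length-++-∷ top) (cong (λ i → suc i + length bot) top≡p))) ⟩
    lookup λs p + length bot ∎)
  where open ≡-Reasoning

fixedHook-at-split : ∀ {k} top bot (p : Fin (length (top ++ k ∷ bot))) → toℕ p ≡ length top →
                     lookup (top ++ k ∷ bot) p ≡ k → suc (length top) ≡ k + length bot → IsFixedHook (top ++ k ∷ bot) p
fixedHook-at-split {k} top bot p p≡ lookup≡ eq = begin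
  hook1 (top ++ k ∷ bot) p               ≡⟨ hook1≡ (top ++ k ∷ bot) p
                                              (trans (length-++-∷ top) (cong (λ i → suc i + length bot) (sym p≡))) ⟩
  lookup (top ++ k ∷ bot) p + length bot ≡⟨ cong (_+ length bot) lookup≡ ⟩
  k + length bot                         ≡⟨ eq ⟨
  suc (length top)                       ≡⟨ cong suc p≡ ⟨
  suc (toℕ p)                            ∎
  where open ≡-Reasoning

split⇒fixedHook : ∀ {k} λs → FixedHookSplit k λs → HasFixedHookOfPart k λs
split⇒fixedHook _ (top , bot , refl , eq) with p , p≡ , lookup≡ ← position-of top _ bot =
  p , fixedHook-at-split top bot p p≡ lookup≡ eq , lookup≡

fixedHook⇒count≡1 : ∀ {n λs} → IsPartition n λs → HasFixedHook λs →
                       count (λ i → hasFixedHookOfPart? (suc i) λs) (upTo n) ≡ 1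
fixedHook⇒count≡1 {n} {λs} π (p , fixed) =
  count-upTo-unique (λ k → hasFixedHookOfPart? k λs) (All.lookup positive (∈-lookup p))
    (All.lookup (Desc≤⇒All≤ λs desc) (∈-lookup p)) (p , fixed , refl)
    (λ h → fixedHookOfPart-unique λs desc h (p , fixed , refl))
  where open IsPartition π

noFixedHook⇒count≡0 : ∀ {n} λs → ¬ HasFixedHook λs → count (λ i → hasFixedHookOfPart? (suc i) λs) (upTo n) ≡ 0
noFixedHook⇒count≡0 {n} λs ¬h =
  cong length (filter-none (λ i → hasFixedHookOfPart? (suc i) λs)
                           (All.universal (λ { i (p , fixed , _) → ¬h (p , fixed) }) (upTo n)))

-- Multiplicities

filter-≟-replicate : ∀ k xs → filter (λ x → x ≟ k) xs ≡ replicate (mult k xs) k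
filter-≟-replicate k []       = refl
filter-≟-replicate k (x ∷ xs) with x ≟ k
... | yes refl rewrite filter-accept (λ x → x ≟ k) {xs = xs} refl = cong (k ∷_) (filter-≟-replicate k xs)
... | no  x≢k  rewrite filter-reject (λ x → x ≟ k) {xs = xs} x≢k  = filter-≟-replicate k xs

filter-above-bound : ∀ k xs → Desc≤ k xs → filter (k <?_) xs ≡ []
filter-above-bound k xs d = filter-none (k <?_) (All.map ≤⇒≯ (Desc≤⇒All≤ xs d))

split-around : ∀ {m} k xs → Desc≤ m xs → xs ≡ filter (k <?_) xs ++ filter (λ x → x ≟ k) xs ++ filter (_<? k) xs
split-around k []       _       = refl
split-around k (x ∷ xs) (_ , d) with <-cmp k x
... | tri< k<x _ _
  rewrite filter-accept (k <?_) {xs = xs} k<x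
        | filter-reject (λ x → x ≟ k) {xs = xs} (>⇒≢ k<x)
        | filter-reject (_<? k) {xs = xs} (<⇒≯ k<x)
  = cong (x ∷_) (split-around k xs d)
... | tri≈ _ refl _
  rewrite filter-reject (k <?_) {xs = xs} (<-irrefl refl)
        | filter-accept (λ x → x ≟ k) {xs = xs} refl
        | filter-reject (_<? k) {xs = xs} (<-irrefl refl)
        | filter-above-bound k xs d
  = cong (k ∷_) (trans (split-around k xs d) (cong (_++ filter (λ x → x ≟ k) xs ++ filter (_<? k) xs) (filter-above-bound k xs d)))
... | tri> _ _ x<k
  rewrite filter-none (k <?_) (All.map (λ y≤x → ≤⇒≯ (≤-trans y≤x (<⇒≤ x<k))) (Desc≤⇒All≤ (x ∷ xs) (≤-refl , d)))
        | filter-none (λ x → x ≟ k) (All.map (λ y≤x → <⇒≢ (≤-<-trans y≤x x<k)) (Desc≤⇒All≤ (x ∷ xs) (≤-refl , d)))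
        | filter-all (_<? k) (All.map (λ y≤x → ≤-<-trans y≤x x<k) (Desc≤⇒All≤ (x ∷ xs) (≤-refl , d)))
  = refl

filter-blocks : ∀ {P : Pred ℕ 0ℓ} (P? : Decidable P) xs ys zs →
                filter P? (xs ++ ys ++ zs) ≡ filter P? xs ++ filter P? ys ++ filter P? zs
filter-blocks P? xs ys zs = trans (filter-++ P? xs _) (cong (filter P? xs ++_) (filter-++ P? ys zs))

module _ (k n : ℕ) {bs ss : List ℕ} (k<bs : All (k <_) bs) (ss<k : All (_< k) ss) where

  filter-above-blocks : filter (k <?_) (bs ++ replicate n k ++ ss) ≡ bs
  filter-above-blocks = begin
    filter (k <?_) (bs ++ replicate n k ++ ss)
      ≡⟨ filter-blocks (k <?_) bs (replicate n k) ss ⟩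
    filter (k <?_) bs ++ filter (k <?_) (replicate n k) ++ filter (k <?_) ss
      ≡⟨ cong₂ _++_ (filter-all (k <?_) k<bs)
                    (cong₂ _++_ (filter-none (k <?_) (All.replicate⁺ n (<-irrefl refl)))
                                (filter-none (k <?_) (All.map <⇒≯ ss<k))) ⟩
    bs ++ []
      ≡⟨ ++-identityʳ bs ⟩
    bs ∎
    where open ≡-Reasoning

  filter-below-blocks : filter (_<? k) (bs ++ replicate n k ++ ss) ≡ ss
  filter-below-blocks = begin
    filter (_<? k) (bs ++ replicate n k ++ ss)
      ≡⟨ filter-blocks (_<? k) bs (replicate n k) ss ⟩
    filter (_<? k) bs ++ filter (_<? k) (replicate n k) ++ filter (_<? k) ss
      ≡⟨ cong₂ _++_ (filter-none (_<? k) (All.map <⇒≯ k<bs))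
                    (cong₂ _++_ (filter-none (_<? k) (All.replicate⁺ n (<-irrefl refl)))
                                (filter-all (_<? k) ss<k)) ⟩
    ss ∎
    where open ≡-Reasoning

  mult-blocks : mult k (bs ++ replicate n k ++ ss) ≡ n
  mult-blocks = begin
    length (filter (λ x → x ≟ k) (bs ++ replicate n k ++ ss))
      ≡⟨ cong length (filter-blocks (λ x → x ≟ k) bs (replicate n k) ss) ⟩
    length (filter (λ x → x ≟ k) bs ++ filter (λ x → x ≟ k) (replicate n k) ++ filter (λ x → x ≟ k) ss)
      ≡⟨ cong length (cong₂ _++_ (filter-none (λ x → x ≟ k) (All.map >⇒≢ k<bs))
                                 (cong₂ _++_ (filter-all (λ x → x ≟ k) (All.replicate⁺ n refl))
                                             (filter-none (λ x → x ≟ k) (All.map <⇒≢ ss<k)))) ⟩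
    length (replicate n k ++ [])
      ≡⟨ cong length (++-identityʳ (replicate n k)) ⟩
    length (replicate n k)
      ≡⟨ length-replicate n ⟩
    n ∎
    where open ≡-Reasoning

fixedMultCount≡count-upTo : ∀ {n λs} → IsPartition n λs →
                            fixedMultCount λs ≡ count (λ i → mult (suc i) λs ≟ suc i) (upTo n)
fixedMultCount≡count-upTo {n} {λs} π =
  unique-⊆⊇⇒length≡ (Unique.filter⁺ P? (Unique.upTo⁺ (length λs))) (Unique.filter⁺ P? (Unique.upTo⁺ n)) inward outward
  where
  open IsPartition π
  P? = λ i → mult (suc i) λs ≟ suc i
  t≤n : length λs ≤ n
  t≤n = subst (length λs ≤_) sum≡ (length≤sum positive)
  inward : filter P? (upTo (length λs)) ⊆ filter P? (upTo n)
  inward i∈ with i∈t , fixed ← ∈-filter⁻ P? {xs = upTo (length λs)} i∈ =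
    ∈-filter⁺ P? (∈-upTo⁺ (≤-trans (∈-upTo⁻ i∈t) t≤n)) fixed
  outward : filter P? (upTo n) ⊆ filter P? (upTo (length λs))
  outward i∈ with _ , fixed ← ∈-filter⁻ P? {xs = upTo n} i∈ =
    ∈-filter⁺ P? (∈-upTo⁺ (subst (_≤ length λs) fixed (length-filter _ λs))) fixed

-- Conjugation

-- conj is conjugation of a nonincreasing list (zero entries allowed); unconj c σ is the
-- conjugate of σ padded with zeros to length c.  removeColumn deletes the first column.
conj : List ℕ → List ℕ
conj []       = []
conj (a ∷ as) = map suc (conj as) ++ replicate (a ∸ length (conj as)) 1

removeColumn : List ℕ → List ℕ
removeColumn σ = map pred (filter (2 ≤?_) σ)

unconj : ℕ → List ℕ → List ℕ
unconj zero    σ = []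
unconj (suc c) σ = length σ ∷ unconj c (removeColumn σ)

conj-length+gap : ∀ {a} as → Desc≤ a as → length (conj as) + (a ∸ length (conj as)) ≡ a

conj-length : ∀ {M} as → Desc≤ M as → length (conj as) ≡ hd as
conj-length []       _       = refl
conj-length (a ∷ as) (_ , d) = begin
  length (map suc (conj as) ++ replicate (a ∸ length (conj as)) 1)
    ≡⟨ length-++ (map suc (conj as)) ⟩
  length (map suc (conj as)) + length (replicate (a ∸ length (conj as)) 1)
    ≡⟨ cong₂ _+_ (length-map suc (conj as)) (length-replicate (a ∸ length (conj as))) ⟩
  length (conj as) + (a ∸ length (conj as))
    ≡⟨ conj-length+gap as d ⟩
  a ∎
  where open ≡-Reasoning

conj-length+gap as d = m+[n∸m]≡n (subst (_≤ _) (sym (conj-length as d)) (hd≤ as d))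

conj-positive : ∀ as → All (0 <_) (conj as)
conj-positive []       = []
conj-positive (a ∷ as) = All.++⁺ (all-map-suc-positive (conj as)) (All.replicate⁺ _ z<s)

conj-desc : ∀ {M} as → Desc≤ M as → Desc≤ (length as) (conj as)
conj-desc []       _       = tt
conj-desc (a ∷ as) (_ , d) =
  Desc≤-++ (map suc (conj as)) _ z<s (Desc≤-map s≤s (conj as) (conj-desc as d))
           (all-map-suc-positive (conj as)) (Desc≤-replicate _ 1)

conj-sum : ∀ {M} as → Desc≤ M as → sum (conj as) ≡ sum as
conj-sum []       _       = refl
conj-sum (a ∷ as) (_ , d) = begin
  sum (map suc (conj as) ++ replicate (a ∸ length (conj as)) 1)
    ≡⟨ sum-++ (map suc (conj as)) _ ⟩
  sum (map suc (conj as)) + sum (replicate (a ∸ length (conj as)) 1)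
    ≡⟨ cong₂ _+_ (sum-map-shift suc (λ x → +-comm 1 x) (conj as)) (sum-replicate (a ∸ length (conj as)) 1) ⟩
  sum (conj as) + length (conj as) * 1 + (a ∸ length (conj as)) * 1
    ≡⟨ cong₂ (λ u v → sum (conj as) + u + v) (*-identityʳ _) (*-identityʳ _) ⟩
  sum (conj as) + length (conj as) + (a ∸ length (conj as))
    ≡⟨ +-assoc (sum (conj as)) _ _ ⟩
  sum (conj as) + (length (conj as) + (a ∸ length (conj as)))
    ≡⟨ cong₂ _+_ (conj-sum as d) (conj-length+gap as d) ⟩
  sum as + a
    ≡⟨ +-comm (sum as) a ⟩
  a + sum as ∎
  where open ≡-Reasoning

removeColumn-conj : ∀ a as → removeColumn (conj (a ∷ as)) ≡ conj as
removeColumn-conj a as = begin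
  map pred (filter (2 ≤?_) (map suc (conj as) ++ replicate (a ∸ length (conj as)) 1))
    ≡⟨ cong (map pred) (filter-++ (2 ≤?_) (map suc (conj as)) _) ⟩
  map pred (filter (2 ≤?_) (map suc (conj as)) ++ filter (2 ≤?_) (replicate (a ∸ length (conj as)) 1))
    ≡⟨ cong₂ (λ u v → map pred (u ++ v))
             (filter-all (2 ≤?_) (All.map⁺ (All.map s≤s (conj-positive as))))
             (filter-none (2 ≤?_) (All.replicate⁺ (a ∸ length (conj as)) λ { (s≤s ()) })) ⟩
  map pred (map suc (conj as) ++ [])
    ≡⟨ cong (map pred) (++-identityʳ _) ⟩
  map pred (map suc (conj as))
    ≡⟨ map-pred-suc (conj as) ⟩
  conj as ∎
  where open ≡-Reasoning

unconj-conj : ∀ {M} as → Desc≤ M as → unconj (length as) (conj as) ≡ as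
unconj-conj []       _         = refl
unconj-conj (a ∷ as) (a≤M , d) =
  cong₂ _∷_ (conj-length (a ∷ as) (a≤M , d)) (trans (cong (unconj (length as)) (removeColumn-conj a as)) (unconj-conj as d))

Desc≤-removeColumn : ∀ c σ → Desc≤ (suc c) σ → Desc≤ c (removeColumn σ)
Desc≤-removeColumn c []                _         = tt
Desc≤-removeColumn c (0 ∷ σ)           (x≤ , d)  = Desc≤-removeColumn c σ (Desc≤-weaken σ x≤ d)
Desc≤-removeColumn c (1 ∷ σ)           (x≤ , d)  = Desc≤-removeColumn c σ (Desc≤-weaken σ x≤ d)
Desc≤-removeColumn c (suc (suc x) ∷ σ) (x≤ , d)  = ≤-pred x≤ , Desc≤-removeColumn (suc x) σ d

removeColumn-positive : ∀ σ → All (0 <_) (removeColumn σ)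
removeColumn-positive []                = []
removeColumn-positive (0 ∷ σ)           = removeColumn-positive σ
removeColumn-positive (1 ∷ σ)           = removeColumn-positive σ
removeColumn-positive (suc (suc x) ∷ σ) = z<s ∷ removeColumn-positive σ

all-ones : ∀ σ → Desc≤ 1 σ → All (0 <_) σ → σ ≡ replicate (length σ) 1
all-ones []      _       _          = refl
all-ones (1 ∷ σ) (_ , d) (_ ∷ pos) = cong (1 ∷_) (all-ones σ d pos)
all-ones (suc (suc _) ∷ σ) (s≤s () , _) _

restore-column : ∀ {m} σ → Desc≤ m σ → All (0 <_) σ →
                 map suc (removeColumn σ) ++ replicate (length σ ∸ length (removeColumn σ)) 1 ≡ σ
restore-column []                _       _         = refl
restore-column (suc (suc x) ∷ σ) (_ , d) (_ ∷ pos) = cong (suc (suc x) ∷_) (restore-column σ d pos)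
restore-column (1 ∷ σ)           (_ , d) (_ ∷ pos) = begin
  map suc (removeColumn σ) ++ replicate (suc (length σ) ∸ length (removeColumn σ)) 1
    ≡⟨ cong (λ r → map suc r ++ replicate (suc (length σ) ∸ length r) 1) no-column ⟩
  1 ∷ replicate (length σ) 1
    ≡⟨ cong (1 ∷_) (all-ones σ d pos) ⟨
  1 ∷ σ ∎
  where
  open ≡-Reasoning
  no-column : removeColumn σ ≡ []
  no-column = cong (map pred) (filter-none (2 ≤?_) (All.map ≤⇒≯ (Desc≤⇒All≤ σ d)))

conj-unconj : ∀ c σ → Desc≤ c σ → All (0 <_) σ → conj (unconj c σ) ≡ σ
conj-unconj zero    []      _         _          = refl
conj-unconj zero    (x ∷ σ) (x≤0 , _) (0<x ∷ _) = ⊥-elim (<⇒≱ 0<x x≤0)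
conj-unconj (suc c) σ       d         pos
  rewrite conj-unconj c (removeColumn σ) (Desc≤-removeColumn c σ d) (removeColumn-positive σ) = restore-column σ d pos

unconj-length : ∀ c σ → length (unconj c σ) ≡ c
unconj-length zero    σ = refl
unconj-length (suc c) σ = cong suc (unconj-length c (removeColumn σ))

unconj-desc : ∀ c σ → Desc≤ (length σ) (unconj c σ)
unconj-desc zero    σ = tt
unconj-desc (suc c) σ = ≤-refl , Desc≤-weaken (unconj c (removeColumn σ)) shorter (unconj-desc c (removeColumn σ))
  where
  shorter : length (removeColumn σ) ≤ length σ
  shorter = ≤-trans (≤-reflexive (length-map pred (filter (2 ≤?_) σ))) (length-filter (2 ≤?_) σ)

-- Merging

-- unmerge c xs gs reads xs as an interleaving of a list as of length c with a list vs:
-- gs lists, for each entry of vs, how many entries of as come after it, and that entry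
-- is raised by this number.  merge inverts it by sorting a_i + (number of a_j with j ≥ i)
-- against the entries of vs.
unmerge : ℕ → List ℕ → List ℕ → List ℕ × List ℕ
unmerge c       xs       []       = xs , []
unmerge c       []       (_ ∷ _)  = [] , []
unmerge c       (x ∷ xs) (g ∷ gs) with g <? c
unmerge c       (x ∷ xs) (g ∷ gs) | no  _ = map₂ (x + c ∷_) (unmerge c xs gs)
unmerge (suc c) (x ∷ xs) (g ∷ gs) | yes _ = map₁ (x ∷_) (unmerge c xs (g ∷ gs))
unmerge zero    (x ∷ xs) (g ∷ gs) | yes ()

Before : ℕ → List ℕ → Set
Before v []       = ⊤
Before v (a ∷ as) = a + length (a ∷ as) ≤ v

before? : ∀ v as → Dec (Before v as)
before? v []       = yes tt
before? v (a ∷ as) = a + length (a ∷ as) ≤? v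

merge : List ℕ → List ℕ → List ℕ × List ℕ
merge as       []       = as , []
merge as       (v ∷ vs) with before? v as
... | yes _ = map₁ (v ∸ length as ∷_) (map₂ (length as ∷_) (merge as vs))
merge []       (v ∷ vs) | no v≱ = ⊥-elim (v≱ tt)
merge (a ∷ as) (v ∷ vs) | no _  = map₁ (a ∷_) (merge as (v ∷ vs))

0≢m+[1+n] : ∀ c {n} → 0 ≢ c + suc n
0≢m+[1+n] c {n} eq = 0≢1+n (trans eq (+-suc c n))

unmerge-length : ∀ c xs gs → length xs ≡ c + length gs →
                 length (proj₁ (unmerge c xs gs)) ≡ c × length (proj₂ (unmerge c xs gs)) ≡ length gs
unmerge-length c       xs       []       len = trans len (+-identityʳ c) , refl
unmerge-length c       []       (g ∷ gs) len = ⊥-elim (0≢m+[1+n] c len)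
unmerge-length c       (x ∷ xs) (g ∷ gs) len with g <? c
unmerge-length (suc c) (x ∷ xs) (g ∷ gs) len | yes _ = map₁ (cong suc) (unmerge-length c xs (g ∷ gs) (suc-injective len))
unmerge-length zero    (x ∷ xs) (g ∷ gs) len | yes ()
unmerge-length c       (x ∷ xs) (g ∷ gs) len | no  _ =
  map₂ (cong suc) (unmerge-length c xs gs (suc-injective (trans len (+-suc c (length gs)))))

unmerge-desc : ∀ {X} c xs gs → Desc≤ X xs → Desc≤ c gs →
               Desc≤ X (proj₁ (unmerge c xs gs)) × Desc≤ (X + c) (proj₂ (unmerge c xs gs))
unmerge-desc c       xs       []       dx _ = dx , tt
unmerge-desc c       []       (g ∷ gs) _  _ = tt , tt
unmerge-desc c       (x ∷ xs) (g ∷ gs) _  _ with g <? c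
unmerge-desc (suc c) (x ∷ xs) (g ∷ gs) (x≤X , dx) (_ , dg) | yes g<1+c
  with da , dv ← unmerge-desc c xs (g ∷ gs) dx (≤-pred g<1+c , dg) =
  (x≤X , da) , Desc≤-weaken (proj₂ (unmerge c xs (g ∷ gs))) (+-mono-≤ x≤X (n≤1+n c)) dv
unmerge-desc zero    (x ∷ xs) (g ∷ gs) _ _ | yes ()
unmerge-desc c       (x ∷ xs) (g ∷ gs) (x≤X , dx) (g≤c , dg) | no _
  with da , dv ← unmerge-desc c xs gs dx (Desc≤-weaken gs g≤c dg) =
  Desc≤-weaken (proj₁ (unmerge c xs gs)) x≤X da , (+-monoˡ-≤ c x≤X , dv)

unmerge-sum : ∀ c xs gs → Desc≤ c gs → length xs ≡ c + length gs →
              sum (proj₁ (unmerge c xs gs)) + sum (proj₂ (unmerge c xs gs)) ≡ sum xs + sum gs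
unmerge-sum c       xs       []       _ _   = refl
unmerge-sum c       []       (g ∷ gs) _ len = ⊥-elim (0≢m+[1+n] c len)
unmerge-sum c       (x ∷ xs) (g ∷ gs) _ _   with g <? c
unmerge-sum (suc c) (x ∷ xs) (g ∷ gs) (_ , dg) len | yes g<1+c = begin
  x + sum a + sum v    ≡⟨ +-assoc x (sum a) (sum v) ⟩
  x + (sum a + sum v)  ≡⟨ cong (x +_) (unmerge-sum c xs (g ∷ gs) (≤-pred g<1+c , dg) (suc-injective len)) ⟩
  x + (sum xs + sum (g ∷ gs)) ≡⟨ +-assoc x (sum xs) _ ⟨
  x + sum xs + sum (g ∷ gs) ∎
  where
  open ≡-Reasoning
  a = proj₁ (unmerge c xs (g ∷ gs))
  v = proj₂ (unmerge c xs (g ∷ gs))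
unmerge-sum zero    (x ∷ xs) (g ∷ gs) _ _ | yes ()
unmerge-sum c       (x ∷ xs) (g ∷ gs) (g≤c , dg) len | no g≮c with refl ← ≤∧≮⇒≡ g≤c g≮c = begin
  sum a + (x + g + sum v)       ≡⟨ shuffle (sum a) x g (sum v) ⟩
  sum a + sum v + (x + g)       ≡⟨ cong (_+ (x + g)) (unmerge-sum g xs gs dg (suc-injective (trans len (+-suc g (length gs))))) ⟩
  sum xs + sum gs + (x + g)     ≡⟨ unshuffle (sum xs) (sum gs) x g ⟩
  x + sum xs + (g + sum gs)     ∎
  where
  open ≡-Reasoning
  a = proj₁ (unmerge g xs gs)
  v = proj₂ (unmerge g xs gs)
  shuffle : ∀ p q r s → p + (q + r + s) ≡ p + s + (q + r)
  shuffle = solve-∀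
  unshuffle : ∀ p q r s → p + q + (r + s) ≡ r + p + (s + q)
  unshuffle = solve-∀

before-desc : ∀ {x} as → Desc≤ x as → Before (x + length as) as
before-desc []       _         = tt
before-desc (a ∷ as) (a≤x , _) = +-monoˡ-≤ (length (a ∷ as)) a≤x

merge-unmerge : ∀ {X} c xs gs → Desc≤ X xs → Desc≤ c gs → length xs ≡ c + length gs →
                uncurry merge (unmerge c xs gs) ≡ (xs , gs)
merge-unmerge c       xs       []       _ _ _   = refl
merge-unmerge c       []       (g ∷ gs) _ _ len = ⊥-elim (0≢m+[1+n] c len)
merge-unmerge c       (x ∷ xs) (g ∷ gs) _ _ _   with g <? c
merge-unmerge c       (x ∷ xs) (g ∷ gs) (_ , dx) (g≤c , dg) len | no g≮c
  with refl ← ≤∧≮⇒≡ g≤c g≮c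
  with unmerge g xs gs
     | merge-unmerge g xs gs dx dg (suc-injective (trans len (+-suc g (length gs))))
     | unmerge-length g xs gs (suc-injective (trans len (+-suc g (length gs))))
     | unmerge-desc g xs gs dx dg
... | as , vs | ih | |as|≡g , _ | das , _ with before? (x + g) as
...   | yes _ rewrite ih | |as|≡g | m+n∸n≡m x g = refl
...   | no x+g≱ = ⊥-elim (x+g≱ (subst (λ l → Before (x + l) as) |as|≡g (before-desc as das)))
merge-unmerge (suc c) (x ∷ xs) (g ∷ gs) (_ , dx) (_ , dg) len | yes g<1+c
  with unmerge c xs (g ∷ gs)
     | merge-unmerge c xs (g ∷ gs) dx (≤-pred g<1+c , dg) (suc-injective len)
     | unmerge-length c xs (g ∷ gs) (suc-injective len)
     | unmerge-desc c xs (g ∷ gs) dx (≤-pred g<1+c , dg)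
... | as , []     | _  | _ , ()     | _
... | as , v ∷ vs | ih | |as|≡c , _ | _ , (v≤x+c , _) with before? v (x ∷ as)
...   | no _ rewrite ih = refl
...   | yes x+1+c≤v = ⊥-elim (<-irrefl refl (begin-strict
  x + c              <⟨ +-monoʳ-< x (n<1+n c) ⟩
  x + suc c          ≡⟨ cong (λ l → x + suc l) |as|≡c ⟨
  x + suc (length as) ≤⟨ x+1+c≤v ⟩
  v                  ≤⟨ v≤x+c ⟩
  x + c              ∎))
  where open ≤-Reasoning
merge-unmerge zero    (x ∷ xs) (g ∷ gs) _ _ _ | yes ()

merge-length : ∀ as vs → length (proj₁ (merge as vs)) ≡ length as + length (proj₂ (merge as vs)) ×
                         length (proj₂ (merge as vs)) ≡ length vs
merge-length as       []       = sym (+-identityʳ (length as)) , refl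
merge-length as       (v ∷ vs) with before? v as
... | yes _ with len₁ , len₂ ← merge-length as vs =
  trans (cong suc len₁) (sym (+-suc (length as) _)) , cong suc len₂
merge-length []       (v ∷ vs) | no v≱ = ⊥-elim (v≱ tt)
merge-length (a ∷ as) (v ∷ vs) | no _ = map₁ (cong suc) (merge-length as (v ∷ vs))

merge-desc₂ : ∀ as vs → Desc≤ (length as) (proj₂ (merge as vs))
merge-desc₂ as       []       = tt
merge-desc₂ as       (v ∷ vs) with before? v as
... | yes _ = ≤-refl , merge-desc₂ as vs
merge-desc₂ []       (v ∷ vs) | no v≱ = ⊥-elim (v≱ tt)
merge-desc₂ (a ∷ as) (v ∷ vs) | no _  = Desc≤-weaken (proj₂ (merge as (v ∷ vs))) (n≤1+n _) (merge-desc₂ as (v ∷ vs))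

before⇒desc : ∀ {M v} as → Desc≤ M as → Before v as → Desc≤ (v ∸ length as) as
before⇒desc []       _       _  = tt
before⇒desc (a ∷ as) (_ , d) a+l≤v = m+n≤o⇒m≤o∸n a a+l≤v , d

not-before⇒ : ∀ {v} a as → ¬ Before v (a ∷ as) → v ∸ length as ≤ a
not-before⇒ {v} a as v≱ = m≤n+o⇒m∸n≤o v (length as) (subst (v ≤_) (+-comm a (length as))
  (≤-pred (subst (v <_) (+-suc a (length as)) (≰⇒> v≱))))

merge-desc₁ : ∀ {M V} as vs → Desc≤ M as → Desc≤ V vs → V ∸ length as ≤ M → Desc≤ M (proj₁ (merge as vs))
merge-desc₁ as       []       da _ _ = da
merge-desc₁ as       (v ∷ vs) da (v≤V , dv) V∸l≤M with before? v as
... | yes v≥ = ≤-trans (∸-monoˡ-≤ (length as) v≤V) V∸l≤M , merge-desc₁ as vs (before⇒desc as da v≥) dv ≤-refl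
merge-desc₁ []       (v ∷ vs) _ _ _ | no v≱ = ⊥-elim (v≱ tt)
merge-desc₁ (a ∷ as) (v ∷ vs) (a≤M , da) (_ , dv) _ | no v≱ =
  a≤M , merge-desc₁ as (v ∷ vs) da (≤-refl , dv) (not-before⇒ a as v≱)

before⇒length≤ : ∀ {v} as → Before v as → length as ≤ v
before⇒length≤ []       _     = z≤n
before⇒length≤ (a ∷ as) a+l≤v = ≤-trans (m≤n+m _ a) a+l≤v

unmerge-merge : ∀ as vs → uncurry (unmerge (length as)) (merge as vs) ≡ (as , vs)
unmerge-merge as       []       = refl
unmerge-merge as       (v ∷ vs) with before? v as
... | yes v≥ with merge as vs | unmerge-merge as vs
...   | xs , gs | ih with length as <? length as
...     | yes l<l = ⊥-elim (<-irrefl refl l<l)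
...     | no _ rewrite ih | m∸n+n≡m (before⇒length≤ as v≥) = refl
unmerge-merge []       (v ∷ vs) | no v≱ = ⊥-elim (v≱ tt)
unmerge-merge (a ∷ as) (v ∷ vs) | no _
  with merge as (v ∷ vs) | unmerge-merge as (v ∷ vs) | merge-desc₂ as (v ∷ vs) | merge-length as (v ∷ vs)
... | xs , []     | _  | _           | _ , ()
... | xs , h ∷ hs | ih | (h≤l , _) | _ with h <? suc (length as)
...   | no h≮ = ⊥-elim (h≮ (s≤s h≤l))
...   | yes _ rewrite ih = refl

-- The bijection

fromHookCoords : ℕ → List ℕ → List ℕ → List ℕ
fromHookCoords c xs gs = map (_+ suc c) xs ++ suc c ∷ map suc gs

fromMultCoords : ℕ → List ℕ → List ℕ → List ℕ
fromMultCoords c as vs = map (_+ suc (suc c)) vs ++ replicate (suc c) (suc c) ++ conj as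

-- The fixed hook in a part c + 1 is at position ⌊(c + t)/2⌋ (from 0), as |top| = c + |bot|.
hookCoords : ℕ → List ℕ → List ℕ × List ℕ
hookCoords c λs = map (_∸ suc c) (take h λs) , map pred (drop (suc h) λs)
  where h = ⌊ c + length λs /2⌋

multCoords : ℕ → List ℕ → List ℕ × List ℕ
multCoords c λs = unconj c (filter (_<? suc c) λs) , map (_∸ suc (suc c)) (filter (suc c <?_) λs)

hookCoords-split : ∀ c top {x} bot → length top ≡ c + length bot →
                   hookCoords c (top ++ x ∷ bot) ≡ (map (_∸ suc c) top , map pred bot)
hookCoords-split c top {x} bot len = begin
  hookCoords c (top ++ x ∷ bot)
    ≡⟨ cong (λ h → map (_∸ suc c) (take h (top ++ x ∷ bot)) , map pred (drop (suc h) (top ++ x ∷ bot))) middle ⟩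
  map (_∸ suc c) (take (length top) (top ++ x ∷ bot)) , map pred (drop (suc (length top)) (top ++ x ∷ bot))
    ≡⟨ cong₂ (λ u v → map (_∸ suc c) u , map pred v) (take-length-++ top) (drop-length-++-∷ top) ⟩
  map (_∸ suc c) top , map pred bot ∎
  where
  open ≡-Reasoning
  middle : ⌊ c + length (top ++ x ∷ bot) /2⌋ ≡ length top
  middle = begin
    ⌊ c + length (top ++ x ∷ bot) /2⌋             ≡⟨ cong (λ l → ⌊ c + l /2⌋) (length-++-∷ top) ⟩
    ⌊ c + (suc (length top) + length bot) /2⌋     ≡⟨ cong ⌊_/2⌋ (x∙yz≈y∙xz c (suc (length top)) (length bot)) ⟩
    ⌊ suc (length top + (c + length bot)) /2⌋     ≡⟨ cong (λ l → ⌊ suc (length top + l) /2⌋) len ⟨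
    ⌊ suc (length top + length top) /2⌋           ≡⟨ ⌊1+n+n/2⌋≡n (length top) ⟩
    length top                                    ∎

hookCoords-fromHookCoords : ∀ c xs gs → length xs ≡ c + length gs → hookCoords c (fromHookCoords c xs gs) ≡ (xs , gs)
hookCoords-fromHookCoords c xs gs len = begin
  hookCoords c (fromHookCoords c xs gs)
    ≡⟨ hookCoords-split c (map (_+ suc c) xs) (map suc gs) len′ ⟩
  map (_∸ suc c) (map (_+ suc c) xs) , map pred (map suc gs)
    ≡⟨ cong₂ _,_ (map-∸-+ (suc c) xs) (map-pred-suc gs) ⟩
  xs , gs ∎
  where
  open ≡-Reasoning
  len′ : length (map (_+ suc c) xs) ≡ c + length (map suc gs)
  len′ = trans (length-map _ xs) (trans len (cong (c +_) (sym (length-map suc gs))))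

above-fromMultCoords : ∀ c vs → All (suc c <_) (map (_+ suc (suc c)) vs)
above-fromMultCoords c vs = All.map⁺ (All.universal (λ v → m≤n+m (suc (suc c)) v) vs)

below-fromMultCoords : ∀ {A} c as → Desc≤ A as → length as ≡ c → All (_< suc c) (conj as)
below-fromMultCoords c as da |as|≡c =
  All.map s≤s (subst (λ l → All (_≤ l) (conj as)) |as|≡c (Desc≤⇒All≤ (conj as) (conj-desc as da)))

multCoords-fromMultCoords : ∀ {A} c as vs → Desc≤ A as → length as ≡ c → multCoords c (fromMultCoords c as vs) ≡ (as , vs)
multCoords-fromMultCoords c as vs da |as|≡c = cong₂ _,_
  (begin
    unconj c (filter (_<? k) (fromMultCoords c as vs)) ≡⟨ cong (unconj c) (filter-below-blocks k k big>k small<k) ⟩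
    unconj c (conj as)                                 ≡⟨ cong (λ l → unconj l (conj as)) |as|≡c ⟨
    unconj (length as) (conj as)                       ≡⟨ unconj-conj as da ⟩
    as ∎)
  (begin
    map (_∸ suc k) (filter (k <?_) (fromMultCoords c as vs)) ≡⟨ cong (map (_∸ suc k)) (filter-above-blocks k k big>k small<k) ⟩
    map (_∸ suc k) (map (_+ suc k) vs)                       ≡⟨ map-∸-+ (suc k) vs ⟩
    vs ∎)
  where
  open ≡-Reasoning
  k = suc c
  big>k = above-fromMultCoords c vs
  small<k = below-fromMultCoords c as da |as|≡c

mult-fromMultCoords : ∀ {A} c as vs → Desc≤ A as → length as ≡ c → mult (suc c) (fromMultCoords c as vs) ≡ suc c
mult-fromMultCoords c as vs da |as|≡c =
  mult-blocks (suc c) (suc c) (above-fromMultCoords c vs) (below-fromMultCoords c as da |as|≡c)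

fromHookCoords-desc : ∀ {X} c xs gs → Desc≤ X xs → Desc≤ c gs → Desc≤ (X + suc c) (fromHookCoords c xs gs)
fromHookCoords-desc {X} c xs gs dx dg =
  Desc≤-++ (map (_+ suc c) xs) _ (m≤n+m (suc c) X) (Desc≤-map (+-monoˡ-≤ (suc c)) xs dx)
           (All.map⁺ (All.universal (λ x → m≤n+m (suc c) x) xs)) (≤-refl , Desc≤-map s≤s gs dg)

fromHookCoords-positive : ∀ c xs gs → All (0 <_) (fromHookCoords c xs gs)
fromHookCoords-positive c xs gs =
  All.++⁺ (All.map⁺ (All.universal (λ x → ≤-trans z<s (m≤n+m (suc c) x)) xs)) (z<s ∷ all-map-suc-positive gs)

fromMultCoords-desc : ∀ {A V} c as vs → Desc≤ A as → length as ≡ c → Desc≤ V vs →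
                      Desc≤ (V + suc (suc c)) (fromMultCoords c as vs)
fromMultCoords-desc {V = V} c as vs da |as|≡c dv =
  Desc≤-++ (map (_+ suc (suc c)) vs) _ (≤-trans (n≤1+n (suc c)) (m≤n+m _ V)) (Desc≤-map (+-monoˡ-≤ (suc (suc c))) vs dv)
           (All.map <⇒≤ (above-fromMultCoords c vs))
           (Desc≤-++ (replicate (suc c) (suc c)) (conj as) (n≤1+n c) (Desc≤-replicate (suc c) (suc c))
                     (All.replicate⁺ (suc c) (n≤1+n c))
                     (subst (λ l → Desc≤ l (conj as)) |as|≡c (conj-desc as da)))

fromMultCoords-positive : ∀ c as vs → All (0 <_) (fromMultCoords c as vs)
fromMultCoords-positive c as vs =
  All.++⁺ (All.map⁺ (All.universal (λ v → ≤-trans z<s (m≤n+m (suc (suc c)) v)) vs))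
          (All.++⁺ (All.replicate⁺ (suc c) z<s) (conj-positive as))

sum-fromHookCoords : ∀ c xs gs → sum (fromHookCoords c xs gs) ≡ sum xs + sum gs + (length xs * suc c + suc c + length gs)
sum-fromHookCoords c xs gs = begin
  sum (map (_+ suc c) xs ++ suc c ∷ map suc gs)
    ≡⟨ sum-++ (map (_+ suc c) xs) _ ⟩
  sum (map (_+ suc c) xs) + (suc c + sum (map suc gs))
    ≡⟨ cong₂ (λ u v → u + (suc c + v)) (sum-map-shift (_+ suc c) (λ _ → refl) xs)
                                        (sum-map-shift suc (λ x → +-comm 1 x) gs) ⟩
  sum xs + length xs * suc c + (suc c + (sum gs + length gs * 1))
    ≡⟨ rearrange (sum xs) (length xs * suc c) (suc c) (sum gs) (length gs) ⟩
  sum xs + sum gs + (length xs * suc c + suc c + length gs) ∎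
  where
  open ≡-Reasoning
  rearrange : ∀ p q r s t → p + q + (r + (s + t * 1)) ≡ p + s + (q + r + t)
  rearrange = solve-∀

sum-fromMultCoords : ∀ {A} c as vs → Desc≤ A as →
                     sum (fromMultCoords c as vs) ≡ sum as + sum vs + (length vs * suc (suc c) + suc c * suc c)
sum-fromMultCoords c as vs da = begin
  sum (map (_+ suc (suc c)) vs ++ replicate (suc c) (suc c) ++ conj as)
    ≡⟨ sum-++ (map (_+ suc (suc c)) vs) _ ⟩
  sum (map (_+ suc (suc c)) vs) + sum (replicate (suc c) (suc c) ++ conj as)
    ≡⟨ cong (sum (map (_+ suc (suc c)) vs) +_) (sum-++ (replicate (suc c) (suc c)) (conj as)) ⟩
  sum (map (_+ suc (suc c)) vs) + (sum (replicate (suc c) (suc c)) + sum (conj as))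
    ≡⟨ cong₂ _+_ (sum-map-shift (_+ suc (suc c)) (λ _ → refl) vs)
                              (cong₂ _+_ (sum-replicate (suc c) (suc c)) (conj-sum as da)) ⟩
  sum vs + length vs * suc (suc c) + (suc c * suc c + sum as)
    ≡⟨ rearrange (sum vs) (length vs * suc (suc c)) (suc c * suc c) (sum as) ⟩
  sum as + sum vs + (length vs * suc (suc c) + suc c * suc c) ∎
  where
  open ≡-Reasoning
  rearrange : ∀ p q r s → p + q + (r + s) ≡ s + p + (q + r)
  rearrange = solve-∀

sum-fromMultCoords≡sum-fromHookCoords : ∀ {A} c xs gs as vs → Desc≤ A as → length xs ≡ c + length gs →
  length vs ≡ length gs → sum as + sum vs ≡ sum xs + sum gs → sum (fromMultCoords c as vs) ≡ sum (fromHookCoords c xs gs)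
sum-fromMultCoords≡sum-fromHookCoords c xs gs as vs da |xs|≡ |vs|≡ sums≡ = begin
  sum (fromMultCoords c as vs)
    ≡⟨ sum-fromMultCoords c as vs da ⟩
  sum as + sum vs + (length vs * suc (suc c) + suc c * suc c)
    ≡⟨ cong₂ (λ s m → s + (m * suc (suc c) + suc c * suc c)) sums≡ |vs|≡ ⟩
  sum xs + sum gs + (length gs * suc (suc c) + suc c * suc c)
    ≡⟨ cong (sum xs + sum gs +_) (weight c (length gs)) ⟨
  sum xs + sum gs + ((c + length gs) * suc c + suc c + length gs)
    ≡⟨ cong (λ l → sum xs + sum gs + (l * suc c + suc c + length gs)) |xs|≡ ⟨
  sum xs + sum gs + (length xs * suc c + suc c + length gs)
    ≡⟨ sum-fromHookCoords c xs gs ⟨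
  sum (fromHookCoords c xs gs) ∎
  where
  open ≡-Reasoning
  weight : ∀ c m → (c + m) * suc c + suc c + m ≡ m * suc (suc c) + suc c * suc c
  weight = solve-∀

fixedHook⇒coords : ∀ {n c λs} → IsPartition n λs → FixedHookSplit (suc c) λs →
  ∃₂ λ xs gs → λs ≡ fromHookCoords c xs gs × Desc≤ n xs × Desc≤ c gs × length xs ≡ c + length gs
fixedHook⇒coords {n} {c} π (top , bot , refl , len) =
  map (_∸ suc c) top , map pred bot ,
  cong₂ (λ u v → u ++ suc c ∷ v) (sym (map-+-∸ (suc c) k≤top)) (sym (map-suc-pred bot-positive)) ,
  Desc≤-weaken _ (m∸n≤m n (suc c)) (Desc≤-map (∸-monoˡ-≤ (suc c)) top dtop) ,
  Desc≤-map pred-mono-≤ bot dbot ,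
  trans (length-map _ top) (trans (suc-injective len) (cong (c +_) (sym (length-map pred bot))))
  where
  open IsPartition π
  dtop = proj₁ (Desc≤-++⁻ top bot desc)
  k≤top = proj₁ (proj₂ (Desc≤-++⁻ top bot desc))
  dbot = proj₂ (proj₂ (Desc≤-++⁻ top bot desc))
  bot-positive = All.tail (All.++⁻ʳ top positive)

fixedMult⇒coords : ∀ {n c λs} → IsPartition n λs → mult (suc c) λs ≡ suc c →
  ∃₂ λ as vs → λs ≡ fromMultCoords c as vs × Desc≤ n as × length as ≡ c × Desc≤ n vs
fixedMult⇒coords {n} {c} {λs} π mult≡ =
  unconj c small , map (_∸ suc k) big , λs≡ ,
  Desc≤-weaken (unconj c small) |small|≤n (unconj-desc c small) , unconj-length c small ,
  Desc≤-weaken _ (m∸n≤m n (suc k)) (Desc≤-map (∸-monoˡ-≤ (suc k)) big (Desc≤-filter (k <?_) λs desc))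
  where
  open IsPartition π
  k = suc c
  big = filter (k <?_) λs
  small = filter (_<? k) λs
  |small|≤n : length small ≤ n
  |small|≤n = ≤-trans (length-filter (_<? k) λs) (subst (length λs ≤_) sum≡ (length≤sum positive))
  small≤c : Desc≤ c small
  small≤c = Desc≤-rebound small (Desc≤-filter (_<? k) λs desc) (All.map ≤-pred (All.all-filter (_<? k) λs))
  λs≡ : λs ≡ fromMultCoords c (unconj c small) (map (_∸ suc k) big)
  λs≡ = begin
    λs                                       ≡⟨ split-around k λs desc ⟩
    big ++ filter (λ x → x ≟ k) λs ++ small  ≡⟨ cong (λ l → big ++ l ++ small) (filter-≟-replicate k λs) ⟩
    big ++ replicate (mult k λs) k ++ small  ≡⟨ cong (λ m → big ++ replicate m k ++ small) mult≡ ⟩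
    big ++ replicate k k ++ small            ≡⟨ cong₂ (λ u v → u ++ replicate k k ++ v)
                                                      (map-+-∸ (suc k) (All.all-filter (k <?_) λs))
                                                      (conj-unconj c small small≤c (All.filter⁺ (_<? k) positive)) ⟨
    fromMultCoords c (unconj c small) (map (_∸ suc k) big) ∎
    where open ≡-Reasoning

toFixedMult : ℕ → List ℕ → List ℕ
toFixedMult c λs = uncurry (fromMultCoords c) (uncurry (unmerge c) (hookCoords c λs))

toFixedHook : ℕ → List ℕ → List ℕ
toFixedHook c λs = uncurry (fromHookCoords c) (uncurry merge (multCoords c λs))

toFixedMult-fromHookCoords : ∀ c xs gs → length xs ≡ c + length gs →
  toFixedMult c (fromHookCoords c xs gs) ≡ uncurry (fromMultCoords c) (unmerge c xs gs)
toFixedMult-fromHookCoords c xs gs len =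
  cong (uncurry (fromMultCoords c) ∘ uncurry (unmerge c)) (hookCoords-fromHookCoords c xs gs len)

toFixedHook-fromMultCoords : ∀ {A} c as vs → Desc≤ A as → length as ≡ c →
  toFixedHook c (fromMultCoords c as vs) ≡ uncurry (fromHookCoords c) (merge as vs)
toFixedHook-fromMultCoords c as vs da |as|≡c =
  cong (uncurry (fromHookCoords c) ∘ uncurry merge) (multCoords-fromMultCoords c as vs da |as|≡c)

toFixedMult-correct : ∀ {n c λs} → IsPartition n λs → HasFixedHookOfPart (suc c) λs →
  IsPartition n (toFixedMult c λs) × mult (suc c) (toFixedMult c λs) ≡ suc c × toFixedHook c (toFixedMult c λs) ≡ λs
toFixedMult-correct {n} {c} {λs} π h
  with xs , gs , refl , dxs , dgs , len ← fixedHook⇒coords π (fixedHook⇒split λs h)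
  rewrite toFixedMult-fromHookCoords c xs gs len
  with |as|≡c , |vs|≡|gs| ← unmerge-length c xs gs len
  with das , dvs ← unmerge-desc c xs gs dxs dgs =
  desc⇒isPartition _ (fromMultCoords-desc c as vs das |as|≡c dvs) (fromMultCoords-positive c as vs)
    (trans (sum-fromMultCoords≡sum-fromHookCoords c xs gs as vs das len |vs|≡|gs| (unmerge-sum c xs gs dgs len))
           (IsPartition.sum≡ π)) ,
  mult-fromMultCoords c as vs das |as|≡c ,
  trans (toFixedHook-fromMultCoords c as vs das |as|≡c) (cong (uncurry (fromHookCoords c)) (merge-unmerge c xs gs dxs dgs len))
  where
  as = proj₁ (unmerge c xs gs)
  vs = proj₂ (unmerge c xs gs)

toFixedHook-correct : ∀ {n c λs} → IsPartition n λs → mult (suc c) λs ≡ suc c →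
  IsPartition n (toFixedHook c λs) × HasFixedHookOfPart (suc c) (toFixedHook c λs) × toFixedMult c (toFixedHook c λs) ≡ λs
toFixedHook-correct {n} {c} {λs} π mult≡
  with as , vs , refl , das , |as|≡c , dvs ← fixedMult⇒coords π mult≡
  rewrite toFixedHook-fromMultCoords c as vs das |as|≡c
  with |xs|≡ , |gs|≡|vs| ← merge-length as vs =
  desc⇒isPartition _ (fromHookCoords-desc c xs gs dxs dgs) (fromHookCoords-positive c xs gs)
    (trans (sym (sum-fromMultCoords≡sum-fromHookCoords c xs gs as vs das len (sym |gs|≡|vs|) sums≡)) (IsPartition.sum≡ π)) ,
  split⇒fixedHook _ (map (_+ suc c) xs , map suc gs , refl , len′) ,
  trans (toFixedMult-fromHookCoords c xs gs len) (cong (uncurry (fromMultCoords c)) unmerge≡)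
  where
  xs = proj₁ (merge as vs)
  gs = proj₂ (merge as vs)
  len : length xs ≡ c + length gs
  len = trans |xs|≡ (cong (_+ length gs) |as|≡c)
  len′ : suc (length (map (_+ suc c) xs)) ≡ suc c + length (map suc gs)
  len′ = cong suc (trans (length-map _ xs) (trans len (cong (c +_) (sym (length-map suc gs)))))
  dxs : Desc≤ n xs
  dxs = merge-desc₁ as vs das dvs (m∸n≤m n (length as))
  dgs : Desc≤ c gs
  dgs = subst (λ l → Desc≤ l gs) |as|≡c (merge-desc₂ as vs)
  unmerge≡ : unmerge c xs gs ≡ (as , vs)
  unmerge≡ = subst (λ l → unmerge l xs gs ≡ (as , vs)) |as|≡c (unmerge-merge as vs)
  sums≡ : sum as + sum vs ≡ sum xs + sum gs
  sums≡ = subst (λ p → sum (proj₁ p) + sum (proj₂ p) ≡ sum xs + sum gs) unmerge≡ (unmerge-sum c xs gs dgs len)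

fixedHookOfPart-count≡fixedMult-count : ∀ n c →
  count (hasFixedHookOfPart? (suc c)) (partitions n) ≡ count (λ λs → mult (suc c) λs ≟ suc c) (partitions n)
fixedHookOfPart-count≡fixedMult-count n c =
  count-≡-by-bijection (partitions-unique n) ∈-partitions⁻ ∈-partitions⁺
    (hasFixedHookOfPart? (suc c)) (λ λs → mult (suc c) λs ≟ suc c) (toFixedMult c) (toFixedHook c)
    (toFixedMult-correct {n}) (toFixedHook-correct {n})

mainTheorem1 : (n : ℕ) → f (suc n) ≡ sum (map fixedMultCount (partitions (suc n)))
mainTheorem1 n = begin
  f N
    ≡⟨ count≡sum hasFixedHook? _ Ps (λ {λs} λs∈ → fixedHook⇒count≡1 {N} {λs} (∈-partitions⁻ λs∈))
                                    (λ {λs} _ → noFixedHook⇒count≡0 {N} λs) ⟩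
  sum (map (λ λs → count (λ i → hasFixedHookOfPart? (suc i) λs) (upTo N)) Ps)
    ≡⟨ double-counting (λ λs i → hasFixedHookOfPart? (suc i) λs) Ps (upTo N) ⟩
  sum (map (λ i → count (hasFixedHookOfPart? (suc i)) Ps) (upTo N))
    ≡⟨ cong sum (map-cong (fixedHookOfPart-count≡fixedMult-count N) (upTo N)) ⟩
  sum (map (λ i → count (λ λs → mult (suc i) λs ≟ suc i) Ps) (upTo N))
    ≡⟨ double-counting (λ λs i → mult (suc i) λs ≟ suc i) Ps (upTo N) ⟨
  sum (map (λ λs → count (λ i → mult (suc i) λs ≟ suc i) (upTo N)) Ps)
    ≡⟨ cong sum (map-cong-local (All.tabulate λ {λs} λs∈ → fixedMultCount≡count-upTo {N} {λs} (∈-partitions⁻ λs∈))) ⟨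
  sum (map fixedMultCount Ps)
    ∎
  where
  open ≡-Reasoning
  N = suc n
  Ps = partitions N
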